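{- Let $A_k(x)=\sum_{\pi\in\mathfrak{S}_k}x^{\mathrm{des}(\pi)}$, define $\widetilde{A}_0(x)=1$ and $\widetilde{A}_n(x)=1+x\sum_{k=1}^{n}\binom{n}{k}A_k(x)$ for $n\ge 1$, and write $\widetilde{A}_n(x)=\sum_k\widetilde{A}(n,k)x^k$. Then for all $n\ge 0$ and all $k$, $$\widetilde{A}(n,k)=\bigl|\{\pi\in\mathcal{Q}_{n+1}:\ \mathrm{asc}(\pi)=k\}\bigr|.$$
   Context: Permutations of $[m]=\{1,\dots,m\}$ are written as words $\pi(1)\cdots\pi(m)$; $\mathfrak{S}_m$ is the set of all of them. $\mathrm{des}(\pi)$ (resp. $\mathrm{asc}(\pi)$) is the number of indices $i\in[m-1]$ with $\pi(i)>\pi(i+1)$ (resp. $\pi(i)<\pi(i+1)$). $\mathcal{Q}_m$ denotes the set of permutations $\pi$ of $[m]$ such that $\pi(1)<\pi(2)<\cdots<\pi(p)$ where $p=\pi^{ -1}(m)$ (i.e. $m$ is the top of the first descent; the identity permutation is included). -}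

module Defs where

open import Data.Nat using (ℕ; zero; suc; _+_; _*_; _<_; _<ᵇ_; _≡ᵇ_)
open import Data.Nat.Combinatorics using (_C_)
open import Data.Bool using (Bool; true; false; _∧_; if_then_else_)
open import Data.List using (List; []; _∷_; length; map; concatMap; filter; upTo)
open import Data.Nat.ListAction using (sum)
open import Data.List.Relation.Unary.Unique.Propositional using (Unique)
open import Data.List.Relation.Unary.AllPairs using (allPairs?)
open import Relation.Nullary.Decidable using (¬?)
open import Data.Nat.Properties using (_≟_)

words : ℕ → ℕ → List (List ℕ)
words n zero = [] ∷ []
words n (suc m) = concatMap (λ a → map (a ∷_) (words n m)) (map suc (upTo n))

-- 𝔖_m: permutations of [m] as words π(1)⋯π(m), i.e. the length-m words
-- over [m] with no repeated letter
perms : ℕ → List (List ℕ)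
perms m = filter (λ w → allPairs? (λ x y → ¬? (x ≟ y)) w) (words m m)

des : List ℕ → ℕ
des (a ∷ b ∷ w) = (if b <ᵇ a then 1 else 0) + des (b ∷ w)
des _ = 0

asc : List ℕ → ℕ
asc (a ∷ b ∷ w) = (if a <ᵇ b then 1 else 0) + asc (b ∷ w)
asc _ = 0

bfilter : {A : Set} → (A → Bool) → List A → List A
bfilter p [] = []
bfilter p (x ∷ xs) = if p x then x ∷ bfilter p xs else bfilter p xs

count : {A : Set} → (A → Bool) → List A → ℕ
count p xs = length (bfilter p xs)

incTo : ℕ → List ℕ → Bool
incTo m [] = true
incTo m (a ∷ []) = true
incTo m (a ∷ b ∷ w) = if a ≡ᵇ m then true else ((a <ᵇ b) ∧ incTo m (b ∷ w))

-- 𝒬_m : permutations of [m] with π(1) < ⋯ < π(p), p = π⁻¹(m)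
Q : ℕ → List (List ℕ)
Q m = bfilter (incTo m) (perms m)

-- Eulerian number A(k,j) = coefficient of x^j in A_k(x) = #{π ∈ 𝔖_k : des π = j}
A : ℕ → ℕ → ℕ
A k j = count (λ π → des π ≡ᵇ j) (perms k)

δ0 : ℕ → ℕ
δ0 zero = 1
δ0 (suc _) = 0

-- coefficient of x^j in  x · Σ_{k=1}^{n} C(n,k) A_k(x)
xSum : ℕ → ℕ → ℕ
xSum n zero = 0
xSum n (suc j) = sum (map (λ k → (n C k) * A k j) (map suc (upTo n)))

Atilde : ℕ → ℕ → ℕ
Atilde zero j = δ0 j
Atilde (suc n) j = δ0 j + xSum (suc n) j

module Submission where

-- Every π ∈ 𝒬 (n + 1) factors uniquely as c ++ (n + 1) ∷ τ, where τ is a word over [n] with distinct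
-- letters and c lists [n] ∖ τ increasingly; so des π = 1 + des τ if τ ≠ [] and des π = 0 otherwise.
-- Words of length k over [n] with distinct letters have C(n,k) times the descent distribution of 𝔖_k:
-- the effect of inserting a new largest letter depends only on the descent number, so both sides obey
-- Pascal's rule. Hence Ã(n,j) counts the π ∈ 𝒬 (n + 1) with des π = j. Finally asc and des are
-- equidistributed on 𝒬 (n + 1): cutting a word at its smallest letter m as α m β and reassembling it
-- recursively as Φ β m, m Φ α or Φ α m (reverse β), according to which of α, β is empty, gives an
-- involution Φ with asc ∘ Φ = des that maps 𝒬 (n + 1) to itself.

open import Defs
open import Data.Bool using (Bool; true; false; T; if_then_else_; _∧_)
open import Data.Nat using (ℕ; zero; suc; _+_; _*_; _∸_; _≤_; _<_; _≡ᵇ_; _<ᵇ_; z≤n; s≤s; _<?_)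
open import Data.Nat.Properties
open import Data.Nat.Combinatorics using (_C_; nCk+nC[k+1]≡[n+1]C[k+1])
open import Data.Nat.ListAction using (sum)
open import Data.Nat.ListAction.Properties using (sum-++; sum-↭)
open import Data.List using (List; []; _∷_; _++_; [_]; length; map; concatMap; filter; filterᵇ; upTo; reverse)
open import Data.List.Properties
  using (map-++; ∷-injective; ∷-injectiveˡ; ∷-injectiveʳ; length-++; length-map; length-applyUpTo; length-reverse;
         reverse-involutive; unfold-reverse; ++-assoc)
open import Data.List.Membership.Propositional using (_∈_; _∉_; find; lose)
open import Data.List.Membership.Propositional.Properties
open import Data.List.Membership.Propositional.Properties.WithK using (unique∧set⇒bag)
open import Data.List.Membership.DecPropositional _≟_ using (_∈?_)
open import Data.List.Relation.Binary.BagAndSetEquality using (∼bag⇒↭)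
open import Data.List.Relation.Binary.Subset.Propositional using (_⊆_)
open import Data.List.Relation.Unary.Sorted.TotalOrder using (Sorted)
open import Data.List.Relation.Unary.Sorted.TotalOrder.Properties using (↗↭↗⇒≋; AllPairs⇒Sorted)
open import Data.List.Relation.Binary.Equality.Propositional using (≋⇒≡)
open import Data.List.Relation.Binary.Permutation.Propositional
  using (_↭_; ↭-refl; ↭-reflexive; ↭-sym; ↭-trans; prep; ↭⇒↭ₛ)
import Data.List.Relation.Binary.Permutation.Propositional.Properties as ↭
import Data.List.Relation.Binary.Permutation.Setoid.Properties as ↭ₛ
open import Data.List.Relation.Unary.All as All using (All; []; _∷_)
import Data.List.Relation.Unary.All.Properties as All
open import Data.List.Relation.Unary.AllPairs as AllPairs using (AllPairs; []; _∷_; allPairs?)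
import Data.List.Relation.Unary.AllPairs.Properties as AllPairs
open import Data.List.Relation.Unary.Any using (here; there)
open import Data.List.Relation.Unary.Unique.Propositional using (Unique)
import Data.List.Relation.Unary.Unique.Propositional.Properties as Unique
open import Data.Product using (∃; ∃₂; _×_; _,_; proj₁; proj₂)
open import Data.Sum using (_⊎_; inj₁; inj₂; [_,_]′)
open import Data.Empty using (⊥-elim)
open import Data.Unit using (tt)
open import Function using (_∘_; mk⇔; Equivalence)
open import Data.Bool.Properties using (T-≡)
open import Relation.Nullary using (¬_; yes; no; contradiction)
open import Relation.Nullary.Decidable using (T?; ¬?)
open import Relation.Binary.PropositionalEquality hiding ([_])
open import Data.Nat.Solver using (module +-*-Solver)
open +-*-Solver

<ᵇ-true : ∀ {m n} → m < n → (m <ᵇ n) ≡ true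
<ᵇ-true {m} {n} m<n with m <ᵇ n | <⇒<ᵇ m<n
... | true | _ = refl

<ᵇ-false : ∀ {m n} → n ≤ m → (m <ᵇ n) ≡ false
<ᵇ-false {m} {n} n≤m with m <ᵇ n in eq
... | false = refl
... | true = contradiction n≤m (<⇒≱ (<ᵇ⇒< m n (subst T (sym eq) tt)))

<ᵇ-true⁻ : ∀ {m n} → (m <ᵇ n) ≡ true → m < n
<ᵇ-true⁻ {m} {n} eq = <ᵇ⇒< m n (subst T (sym eq) tt)

≡ᵇ-refl : ∀ m → (m ≡ᵇ m) ≡ true
≡ᵇ-refl zero = refl
≡ᵇ-refl (suc m) = ≡ᵇ-refl m

≡ᵇ-false : ∀ {m n} → m ≢ n → (m ≡ᵇ n) ≡ false
≡ᵇ-false {m} {n} m≢n with m ≡ᵇ n in eq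
... | false = refl
... | true = contradiction (≡ᵇ⇒≡ m n (subst T (sym eq) tt)) m≢n

∧-true⁻ : ∀ {a b} → (a ∧ b) ≡ true → a ≡ true × b ≡ true
∧-true⁻ {true} e = refl , e

if-false : ∀ {b x} → b ≡ false → (if b then true else x) ≡ true → x ≡ true
if-false refl e = e

private
  variable
    X Y : Set

∑ : (X → ℕ) → List X → ℕ
∑ g xs = sum (map g xs)

∑-++ : (g : X → ℕ) (xs ys : List X) → ∑ g (xs ++ ys) ≡ ∑ g xs + ∑ g ys
∑-++ g xs ys = trans (cong sum (map-++ g xs ys)) (sum-++ (map g xs) (map g ys))

∑-map : (g : Y → ℕ) (f : X → Y) (xs : List X) → ∑ g (map f xs) ≡ ∑ (g ∘ f) xs
∑-map g f [] = refl
∑-map g f (x ∷ xs) = cong (g (f x) +_) (∑-map g f xs)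

∑-cong : {g h : X → ℕ} (xs : List X) → (∀ {x} → x ∈ xs → g x ≡ h x) → ∑ g xs ≡ ∑ h xs
∑-cong [] _ = refl
∑-cong (x ∷ xs) g≡h = cong₂ _+_ (g≡h (here refl)) (∑-cong xs (g≡h ∘ there))

∑-↭ : (g : X → ℕ) {xs ys : List X} → xs ↭ ys → ∑ g xs ≡ ∑ g ys
∑-↭ g p = sum-↭ (↭.map⁺ g p)

∑-concatMap : (g : Y → ℕ) (f : X → List Y) (xs : List X) → ∑ g (concatMap f xs) ≡ ∑ (∑ g ∘ f) xs
∑-concatMap g f [] = refl
∑-concatMap g f (x ∷ xs) =
  trans (∑-++ g (f x) (concatMap f xs)) (cong (∑ g (f x) +_) (∑-concatMap g f xs))

∑-zero : (xs : List X) → ∑ (λ _ → 0) xs ≡ 0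
∑-zero [] = refl
∑-zero (x ∷ xs) = ∑-zero xs

indicator : Bool → ℕ
indicator true = 1
indicator false = 0

bfilter≡filter : (p : X → Bool) (xs : List X) → bfilter p xs ≡ filterᵇ p xs
bfilter≡filter p [] = refl
bfilter≡filter p (x ∷ xs) with p x
... | true = cong (x ∷_) (bfilter≡filter p xs)
... | false = bfilter≡filter p xs

count≡∑ : (p : X → Bool) (xs : List X) → count p xs ≡ ∑ (indicator ∘ p) xs
count≡∑ p [] = refl
count≡∑ p (x ∷ xs) with p x
... | true = cong suc (count≡∑ p xs)
... | false = count≡∑ p xs

∈-bfilter⁻ : ∀ {p : X → Bool} {xs x} → x ∈ bfilter p xs → x ∈ xs × p x ≡ true
∈-bfilter⁻ {p = p} {xs} x∈ with ∈-filter⁻ (T? ∘ p) (subst (_ ∈_) (bfilter≡filter p xs) x∈)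
... | x∈xs , px = x∈xs , Equivalence.to T-≡ px

∈-bfilter⁺ : ∀ {p : X → Bool} {xs x} → x ∈ xs → p x ≡ true → x ∈ bfilter p xs
∈-bfilter⁺ {p = p} {xs} x∈xs px =
  subst (_ ∈_) (sym (bfilter≡filter p xs)) (∈-filter⁺ (T? ∘ p) x∈xs (Equivalence.from T-≡ px))

bfilter-unique : ∀ (p : X → Bool) {xs} → Unique xs → Unique (bfilter p xs)
bfilter-unique p {xs} u = subst Unique (sym (bfilter≡filter p xs)) (Unique.filter⁺ (T? ∘ p) u)

AllPairs-++⁻ : ∀ {R : X → X → Set} (xs : List X) {ys} →
  AllPairs R (xs ++ ys) → AllPairs R xs × AllPairs R ys
AllPairs-++⁻ [] p = [] , p
AllPairs-++⁻ (x ∷ xs) (px ∷ p) with AllPairs-++⁻ xs p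
... | pxs , pys = All.++⁻ˡ xs px ∷ pxs , pys

length-mid : (u : List X) (x : X) (v : List X) → length (u ++ x ∷ v) ≡ suc (length (u ++ v))
length-mid [] x v = refl
length-mid (a ∷ u) x v = cong suc (length-mid u x v)

∈-mid⁻ : ∀ (u : List X) {v x y} → y ∈ u ++ x ∷ v → y ≢ x → y ∈ u ++ v
∈-mid⁻ u y∈ y≢x with ∈-++⁻ u y∈
... | inj₁ p = ∈-++⁺ˡ p
... | inj₂ (here y≡x) = contradiction y≡x y≢x
... | inj₂ (there p) = ∈-++⁺ʳ u p

Unique-resp-↭ : {xs ys : List X} → xs ↭ ys → Unique xs → Unique ys
Unique-resp-↭ p = ↭ₛ.Unique-resp-↭ (setoid _) (↭⇒↭ₛ p)

unique⊆⇒length≤ : {xs ys : List X} → Unique xs → xs ⊆ ys → length xs ≤ length ys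
unique⊆⇒length≤ {xs = []} _ _ = z≤n
unique⊆⇒length≤ {xs = x ∷ xs} (x∉xs ∷ u) sub with ∈-∃++ (sub (here refl))
... | u₁ , v₁ , refl =
  ≤-trans (s≤s (unique⊆⇒length≤ u sub′)) (≤-reflexive (sym (length-mid u₁ x v₁)))
  where
  sub′ : xs ⊆ u₁ ++ v₁
  sub′ y∈xs = ∈-mid⁻ u₁ (sub (there y∈xs)) (λ { refl → All.lookup x∉xs y∈xs refl })

unique∧⊆⇒↭ : {xs ys : List X} → Unique xs → Unique ys → xs ⊆ ys → ys ⊆ xs → xs ↭ ys
unique∧⊆⇒↭ ux uy xs⊆ys ys⊆xs = ∼bag⇒↭ (unique∧set⇒bag ux uy (mk⇔ xs⊆ys ys⊆xs))

Unique-map : (f : X → Y) {xs : List X} → (∀ {x y} → x ∈ xs → y ∈ xs → f x ≡ f y → x ≡ y) →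
  Unique xs → Unique (map f xs)
Unique-map f {[]} _ [] = []
Unique-map f {x ∷ xs} inj (x∉xs ∷ u) =
  fresh xs x∉xs there ∷ Unique-map f (λ p q → inj (there p) (there q)) u
  where
  fresh : ∀ ys → All (x ≢_) ys → ys ⊆ x ∷ xs → All (f x ≢_) (map f ys)
  fresh [] [] _ = []
  fresh (y ∷ ys) (x≢y ∷ ps) sub =
    (x≢y ∘ inj (here refl) (sub (here refl))) ∷ fresh ys ps (sub ∘ there)

Unique-concatMap : (f : X → List Y) (ℓ : Y → X) {xs : List X} →
  (∀ {x y} → x ∈ xs → y ∈ f x → ℓ y ≡ x) →
  Unique xs → (∀ {x} → x ∈ xs → Unique (f x)) → Unique (concatMap f xs)
Unique-concatMap f ℓ {[]} _ [] _ = []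
Unique-concatMap f ℓ {x ∷ xs} label (x∉xs ∷ u) uf =
  Unique.++⁺ (uf (here refl)) (Unique-concatMap f ℓ (label ∘ there) u (uf ∘ there)) disjoint
  where
  disjoint : ∀ {y} → ¬ (y ∈ f x × y ∈ concatMap f xs)
  disjoint (y∈fx , y∈rest) with find (∈-concatMap⁻ f {xs = xs} y∈rest)
  ... | x′ , x′∈xs , y∈fx′ =
    All.lookup x∉xs x′∈xs (trans (sym (label (here refl) y∈fx)) (label (there x′∈xs) y∈fx′))

Unique-++-disjoint : ∀ (u : List X) {v x} → Unique (u ++ v) → x ∈ u → x ∉ v
Unique-++-disjoint (a ∷ u) (a∉ ∷ _) (here refl) x∈v = All.lookup (All.++⁻ʳ u a∉) x∈v refl
Unique-++-disjoint (a ∷ u) (_ ∷ uu) (there x∈) = Unique-++-disjoint u uu x∈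

mid-injective : ∀ {M : X} u u′ {v v′} → M ∉ u → M ∉ u′ → u ++ M ∷ v ≡ u′ ++ M ∷ v′ → v ≡ v′
mid-injective [] [] _ _ e = ∷-injectiveʳ e
mid-injective [] (a ∷ u′) _ M∉u′ e = contradiction (here (∷-injectiveˡ e)) M∉u′
mid-injective (a ∷ u) [] M∉u _ e = contradiction (here (sym (∷-injectiveˡ e))) M∉u
mid-injective (a ∷ u) (a′ ∷ u′) M∉u M∉u′ e =
  mid-injective u u′ (M∉u ∘ there) (M∉u′ ∘ there) (∷-injectiveʳ e)


length-suc⇒≢[] : ∀ {w : List X} {n} → length w ≡ suc n → w ≢ []
length-suc⇒≢[] |w|≡1+n refl = 0≢1+n |w|≡1+n

reverse-∷≢[] : ∀ (b : X) β → reverse (b ∷ β) ≢ []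
reverse-∷≢[] b β = length-suc⇒≢[] (length-reverse (b ∷ β))

All-reverse : ∀ {P : X → Set} {w} → All P w → All P (reverse w)
All-reverse {w = w} = ↭.All-resp-↭ (↭-sym (↭.↭-reverse w))

∑-involution : (ι : X → X) {xs : List X} → Unique xs → (∀ {x} → x ∈ xs → ι x ∈ xs) →
  (∀ {x} → x ∈ xs → ι (ι x) ≡ x) →
  (g : X → ℕ) → ∑ g xs ≡ ∑ (g ∘ ι) xs
∑-involution ι {xs} u closed involutive g = trans (∑-↭ g (↭-sym ιxs↭xs)) (∑-map g ι xs)
  where
  injective : ∀ {x y} → x ∈ xs → y ∈ xs → ι x ≡ ι y → x ≡ y
  injective x∈ y∈ e = trans (sym (involutive x∈)) (trans (cong ι e) (involutive y∈))
  onto : ∀ {x} → x ∈ xs → x ∈ map ι xs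
  onto x∈ = subst (_∈ map ι xs) (involutive x∈) (∈-map⁺ ι (closed x∈))
  into : ∀ {y} → y ∈ map ι xs → y ∈ xs
  into y∈ with ∈-map⁻ ι y∈
  ... | x , x∈ , refl = closed x∈
  ιxs↭xs : map ι xs ↭ xs
  ιxs↭xs = unique∧⊆⇒↭ (Unique-map ι injective u) u into onto

InRange : ℕ → ℕ → Set
InRange n a = 0 < a × a ≤ n

range : ℕ → List ℕ
range n = map suc (upTo n)

∈-range⁻ : ∀ {n a} → a ∈ range n → InRange n a
∈-range⁻ a∈ with ∈-map⁻ suc a∈
... | _ , i∈ , refl = s≤s z≤n , ∈-upTo⁻ i∈

∈-range⁺ : ∀ {n a} → InRange n a → a ∈ range n
∈-range⁺ {a = suc a} (_ , a<n) = ∈-map⁺ suc (∈-upTo⁺ a<n)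

range-unique : ∀ n → Unique (range n)
range-unique n = Unique.map⁺ suc-injective (Unique.upTo⁺ n)

length-range : ∀ n → length (range n) ≡ n
length-range n = trans (length-map suc (upTo n)) (length-applyUpTo (λ i → i) n)

InRange-suc : ∀ {n a} → InRange n a → InRange (suc n) a
InRange-suc (0<a , a≤n) = 0<a , m≤n⇒m≤1+n a≤n

InRange-top : ∀ n → InRange (suc n) (suc n)
InRange-top n = s≤s z≤n , ≤-refl

InRange-pred : ∀ {n a} → InRange (suc n) a → a ≢ suc n → InRange n a
InRange-pred (0<a , a≤1+n) a≢1+n = 0<a , ≤-pred (≤∧≢⇒< a≤1+n a≢1+n)

top∉ : ∀ {n w} → All (InRange n) w → suc n ∉ w
top∉ (p ∷ _) (here refl) = <-irrefl refl (proj₂ p)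
top∉ (_ ∷ ps) (there m) = top∉ ps m

unique-full : ∀ {N w a} → Unique w → All (InRange N) w → length w ≡ N → InRange N a → a ∈ w
unique-full {N} {w} {a} u w⊆[N] |w|≡N a∈[N] with a ∈? w
... | yes a∈w = a∈w
... | no a∉w = ⊥-elim (<-irrefl refl (begin-strict
      N                ≡⟨ sym |w|≡N ⟩
      length w         <⟨ n<1+n (length w) ⟩
      length (a ∷ w)   ≤⟨ unique⊆⇒length≤ (All.tabulate (λ { m refl → a∉w m }) ∷ u) a∷w⊆[N] ⟩
      length (range N) ≡⟨ length-range N ⟩
      N                ∎))
  where
  open ≤-Reasoning
  a∷w⊆[N] : a ∷ w ⊆ range N
  a∷w⊆[N] (here refl) = ∈-range⁺ a∈[N]
  a∷w⊆[N] (there m) = ∈-range⁺ (All.lookup w⊆[N] m)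

words-unique : ∀ n m → Unique (words n m)
words-unique n zero = [] ∷ []
words-unique n (suc m) = Unique-concatMap (λ a → map (a ∷_) (words n m)) head label (range-unique n)
  (λ _ → Unique.map⁺ ∷-injectiveʳ (words-unique n m))
  where
  head : List ℕ → ℕ
  head [] = 0
  head (a ∷ _) = a
  label : ∀ {a w} → a ∈ range n → w ∈ map (a ∷_) (words n m) → head w ≡ a
  label _ w∈ with ∈-map⁻ _ w∈
  ... | _ , _ , refl = refl

∈-words⁻ : ∀ {n m w} → w ∈ words n m → length w ≡ m × All (InRange n) w
∈-words⁻ {m = zero} (here refl) = refl , []
∈-words⁻ {n} {suc m} w∈ with find (∈-concatMap⁻ (λ a → map (a ∷_) (words n m)) {xs = range n} w∈)
... | a , a∈ , w∈′ with ∈-map⁻ _ w∈′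
... | w′ , w′∈ , refl with ∈-words⁻ {n} {m} w′∈
... | |w′| , w′⊆ = cong suc |w′| , ∈-range⁻ a∈ ∷ w′⊆

∈-words⁺ : ∀ {n m w} → length w ≡ m → All (InRange n) w → w ∈ words n m
∈-words⁺ {m = zero} {[]} refl [] = here refl
∈-words⁺ {n} {suc m} {a ∷ w} |w| (a∈ ∷ w⊆) =
  ∈-concatMap⁺ (λ a → map (a ∷_) (words n m))
    (lose (∈-range⁺ a∈) (∈-map⁺ (a ∷_) (∈-words⁺ (suc-injective |w|) w⊆)))

-- `perms m` unfolds to `injWords m m`
injWords : ℕ → ℕ → List (List ℕ)
injWords n k = filter (allPairs? (λ x y → ¬? (x ≟ y))) (words n k)

injWords-unique : ∀ n k → Unique (injWords n k)
injWords-unique n k = Unique.filter⁺ _ (words-unique n k)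

∈-injWords⁻ : ∀ {n k w} → w ∈ injWords n k → length w ≡ k × All (InRange n) w × Unique w
∈-injWords⁻ {n} {k} w∈ with ∈-filter⁻ (allPairs? (λ x y → ¬? (x ≟ y))) w∈
... | w∈words , u with ∈-words⁻ {n} {k} w∈words
... | |w| , w⊆ = |w| , w⊆ , u

∈-injWords⁺ : ∀ {n k w} → length w ≡ k → All (InRange n) w → Unique w → w ∈ injWords n k
∈-injWords⁺ |w| w⊆ u = ∈-filter⁺ (allPairs? (λ x y → ¬? (x ≟ y))) (∈-words⁺ |w| w⊆) u

Increasing : List ℕ → Set
Increasing = AllPairs _<_

increasing-∷ : ∀ {a b u} → a < b → Increasing (b ∷ u) → Increasing (a ∷ b ∷ u)
increasing-∷ a<b b∷u↗@(b<u ∷ _) = (a<b ∷ All.map (<-trans a<b) b<u) ∷ b∷u↗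

increasing-↭⇒≡ : ∀ {xs ys} → Increasing xs → Increasing ys → xs ↭ ys → xs ≡ ys
increasing-↭⇒≡ xs↗ ys↗ xs↭ys = ≋⇒≡ (↗↭↗⇒≋ ≤-totalOrder (sorted xs↗) (sorted ys↗) (↭⇒↭ₛ xs↭ys))
  where
  sorted : ∀ {w} → Increasing w → Sorted ≤-totalOrder w
  sorted w↗ = AllPairs⇒Sorted ≤-totalOrder (AllPairs.map <⇒≤ w↗)

increasing-unique : ∀ {w} → Increasing w → Unique w
increasing-unique = AllPairs.map <⇒≢

range-increasing : ∀ n → Increasing (range n)
range-increasing n = AllPairs.map⁺ (AllPairs.applyUpTo⁺₁ (λ i → i) n (λ i<j _ → s≤s i<j))

increasing-snoc : ∀ {M} u → Increasing u → All (_< M) u → Increasing (u ++ [ M ])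
increasing-snoc u u↗ u<M = AllPairs.++⁺ u↗ ([] ∷ []) (All.map (_∷ []) u<M)

des-++ : ∀ u a v → des (u ++ a ∷ v) ≡ des (u ++ [ a ]) + des (a ∷ v)
des-++ [] a v = refl
des-++ (x ∷ []) a v = cong (_+ des (a ∷ v)) (sym (+-identityʳ _))
des-++ (x ∷ y ∷ u) a v = trans (cong ((if y <ᵇ x then 1 else 0) +_) (des-++ (y ∷ u) a v))
  (sym (+-assoc (if y <ᵇ x then 1 else 0) _ _))

asc-++ : ∀ u a v → asc (u ++ a ∷ v) ≡ asc (u ++ [ a ]) + asc (a ∷ v)
asc-++ [] a v = refl
asc-++ (x ∷ []) a v = cong (_+ asc (a ∷ v)) (sym (+-identityʳ _))
asc-++ (x ∷ y ∷ u) a v = trans (cong ((if x <ᵇ y then 1 else 0) +_) (asc-++ (y ∷ u) a v))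
  (sym (+-assoc (if x <ᵇ y then 1 else 0) _ _))

asc-reverse : ∀ w → asc (reverse w) ≡ des w
asc-reverse [] = refl
asc-reverse (x ∷ []) = refl
asc-reverse (x ∷ y ∷ w) = begin
  asc (reverse (x ∷ y ∷ w))                  ≡⟨ cong asc (unfold-reverse x (y ∷ w)) ⟩
  asc (reverse (y ∷ w) ++ [ x ])             ≡⟨ cong (λ z → asc (z ++ [ x ])) (unfold-reverse y w) ⟩
  asc ((reverse w ++ [ y ]) ++ [ x ])        ≡⟨ cong asc (++-assoc (reverse w) [ y ] [ x ]) ⟩
  asc (reverse w ++ y ∷ [ x ])               ≡⟨ asc-++ (reverse w) y [ x ] ⟩
  asc (reverse w ++ [ y ]) + asc (y ∷ [ x ])
    ≡⟨ cong₂ _+_ (cong asc (sym (unfold-reverse y w))) (+-identityʳ _) ⟩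
  asc (reverse (y ∷ w)) + b                  ≡⟨ cong (_+ b) (asc-reverse (y ∷ w)) ⟩
  des (y ∷ w) + b                            ≡⟨ +-comm (des (y ∷ w)) b ⟩
  des (x ∷ y ∷ w)                            ∎
  where
  open ≡-Reasoning
  b = if y <ᵇ x then 1 else 0

asc-snoc-≤ : ∀ {m} u → All (m ≤_) u → asc (u ++ [ m ]) ≡ asc u
asc-snoc-≤ [] _ = refl
asc-snoc-≤ (x ∷ []) (m≤x ∷ []) rewrite <ᵇ-false m≤x = refl
asc-snoc-≤ (x ∷ y ∷ u) (_ ∷ ps) = cong ((if x <ᵇ y then 1 else 0) +_) (asc-snoc-≤ (y ∷ u) ps)

des-snoc-< : ∀ {m} u → All (m <_) u → u ≢ [] → des (u ++ [ m ]) ≡ suc (des u)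
des-snoc-< [] _ u≢[] = contradiction refl u≢[]
des-snoc-< (x ∷ []) (m<x ∷ []) _ rewrite <ᵇ-true m<x = refl
des-snoc-< (x ∷ y ∷ u) (_ ∷ ps) _ =
  trans (cong (b +_) (des-snoc-< (y ∷ u) ps (λ ()))) (+-suc b (des (y ∷ u)))
  where b = if y <ᵇ x then 1 else 0

des-cons-≤ : ∀ {m} u → All (m ≤_) u → des (m ∷ u) ≡ des u
des-cons-≤ [] _ = refl
des-cons-≤ (x ∷ u) (m≤x ∷ _) rewrite <ᵇ-false m≤x = refl

asc-cons-< : ∀ {m} u → All (m <_) u → u ≢ [] → asc (m ∷ u) ≡ suc (asc u)
asc-cons-< [] _ u≢[] = contradiction refl u≢[]
asc-cons-< (x ∷ u) (m<x ∷ _) _ rewrite <ᵇ-true m<x = refl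

asc+des : ∀ x xs → Unique (x ∷ xs) → asc (x ∷ xs) + des (x ∷ xs) ≡ length xs
asc+des x [] _ = refl
asc+des x (y ∷ ys) ((x≢y ∷ _) ∷ u) with x <? y
... | yes x<y rewrite <ᵇ-true x<y | <ᵇ-false (<⇒≤ x<y) = cong suc (asc+des y ys u)
... | no x≮y rewrite <ᵇ-false (≮⇒≥ x≮y) | <ᵇ-true (≤∧≢⇒< (≮⇒≥ x≮y) (x≢y ∘ sym)) =
  trans (+-suc (asc (y ∷ ys)) (des (y ∷ ys))) (cong suc (asc+des y ys u))

des-increasing : ∀ {w} → Increasing w → des w ≡ 0
des-increasing {[]} _ = refl
des-increasing {x ∷ []} _ = refl
des-increasing {x ∷ y ∷ w} ((x<y ∷ _) ∷ inc) rewrite <ᵇ-false (<⇒≤ x<y) = des-increasing inc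

incTo-here : ∀ M w → incTo M (M ∷ w) ≡ true
incTo-here M [] = refl
incTo-here M (b ∷ w) rewrite ≡ᵇ-refl M = refl

incTo-∷∷⁻ : ∀ {M a b w} → incTo M (a ∷ b ∷ w) ≡ true →
  a ≡ M ⊎ (a < b × incTo M (b ∷ w) ≡ true)
incTo-∷∷⁻ {M} {a} inc with a ≟ M
... | yes a≡M = inj₁ a≡M
... | no a≢M = inj₂ (<ᵇ-true⁻ (proj₁ a<b∧inc) , proj₂ a<b∧inc)
  where a<b∧inc = ∧-true⁻ (if-false (≡ᵇ-false a≢M) inc)

incTo-∷∷⁺ : ∀ {M a b} w → a < b → incTo M (b ∷ w) ≡ true → incTo M (a ∷ b ∷ w) ≡ true
incTo-∷∷⁺ {M} {a} w a<b inc with a ≡ᵇ M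
... | true = refl
... | false rewrite <ᵇ-true a<b = inc

incTo-∷⁺ : ∀ {M m} u → m ≢ M → All (m <_) u → incTo M u ≡ true → incTo M (m ∷ u) ≡ true
incTo-∷⁺ [] _ _ _ = refl
incTo-∷⁺ (c ∷ u) _ (m<c ∷ _) inc = incTo-∷∷⁺ u m<c inc

incTo-++⁻ : ∀ {M} u v → incTo M (u ++ v) ≡ true → incTo M u ≡ true
incTo-++⁻ [] v _ = refl
incTo-++⁻ (a ∷ []) v _ = refl
incTo-++⁻ {M} (a ∷ b ∷ u) v inc =
  [ (λ { refl → incTo-here M (b ∷ u) })
  , (λ (a<b , inc′) → incTo-∷∷⁺ u a<b (incTo-++⁻ (b ∷ u) v inc′))
  ]′ (incTo-∷∷⁻ {w = u ++ v} inc)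

incTo-++⁺ : ∀ {M} u v → incTo M u ≡ true → M ∈ u → incTo M (u ++ v) ≡ true
incTo-++⁺ {M} (a ∷ u) v _ (here refl) = incTo-here M (u ++ v)
incTo-++⁺ (a ∷ []) v _ (there ())
incTo-++⁺ {M} (a ∷ b ∷ u) v inc (there M∈) with incTo-∷∷⁻ {M} {a} {b} {u} inc
... | inj₁ refl = incTo-here M (b ∷ u ++ v)
... | inj₂ (a<b , inc′) = incTo-∷∷⁺ (u ++ v) a<b (incTo-++⁺ (b ∷ u) v inc′ M∈)

incTo-descent : ∀ {M c} a α v → M ∉ a ∷ α → All (c <_) (a ∷ α) →
  incTo M ((a ∷ α) ++ c ∷ v) ≢ true
incTo-descent {M} {c} a [] v M∉ (c<a ∷ []) inc with incTo-∷∷⁻ {M} {a} {c} {v} inc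
... | inj₁ refl = M∉ (here refl)
... | inj₂ (a<c , _) = <-asym a<c c<a
incTo-descent {M} {c} a (a′ ∷ α) v M∉ (_ ∷ ps) inc with incTo-∷∷⁻ {M} {a} {a′} {α ++ c ∷ v} inc
... | inj₁ refl = M∉ (here refl)
... | inj₂ (_ , inc′) = incTo-descent a′ α v (M∉ ∘ there) ps inc′

incTo-increasing : ∀ {M} u v → Increasing u → All (_< M) u → incTo M (u ++ M ∷ v) ≡ true
incTo-increasing {M} [] v _ _ = incTo-here M v
incTo-increasing (a ∷ []) v _ (a<M ∷ []) = incTo-∷∷⁺ v a<M (incTo-here _ v)
incTo-increasing (a ∷ b ∷ u) v ((a<b ∷ _) ∷ u↗) (_ ∷ u<M) =
  incTo-∷∷⁺ (u ++ _ ∷ v) a<b (incTo-increasing (b ∷ u) v u↗ u<M)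

incTo-increasing⁻ : ∀ {M} u v → M ∉ u → incTo M (u ++ M ∷ v) ≡ true → Increasing u
incTo-increasing⁻ [] v _ _ = []
incTo-increasing⁻ (a ∷ []) v _ _ = [] ∷ []
incTo-increasing⁻ {M} (a ∷ b ∷ u) v M∉ inc =
  [ (λ a≡M → contradiction (here (sym a≡M)) M∉)
  , (λ (a<b , inc′) → increasing-∷ a<b (incTo-increasing⁻ (b ∷ u) v (M∉ ∘ there) inc′))
  ]′ (incTo-∷∷⁻ {w = u ++ M ∷ v} inc)

∈-Q⁻ : ∀ {N w} → w ∈ Q N → length w ≡ N × All (InRange N) w × Unique w × incTo N w ≡ true
∈-Q⁻ {N} w∈ with ∈-bfilter⁻ {xs = injWords N N} w∈
... | w∈perms , inc with ∈-injWords⁻ {N} {N} w∈perms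
... | |w| , w⊆ , u = |w| , w⊆ , u , inc

∈-Q⁺ : ∀ {N w} → length w ≡ N → All (InRange N) w → Unique w → incTo N w ≡ true → w ∈ Q N
∈-Q⁺ |w| w⊆ u inc = ∈-bfilter⁺ (∈-injWords⁺ |w| w⊆ u) inc

Q-unique : ∀ N → Unique (Q N)
Q-unique N = bfilter-unique (incTo N) (injWords-unique N N)

-- An involution exchanging ascents and descents

Split : Set
Split = List ℕ × ℕ × List ℕ

IsMinSplit : List ℕ → Split → Set
IsMinSplit w (α , m , β) = w ≡ α ++ m ∷ β × All (m <_) α × All (m ≤_) β

minSplit-step : ℕ → List ℕ → Split → Split
minSplit-step x ys (α , m , β) = if m <ᵇ x then (x ∷ α , m , β) else ([] , x , ys)

minSplit : ℕ → List ℕ → Split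
minSplit x [] = [] , x , []
minSplit x (y ∷ ys) = minSplit-step x (y ∷ ys) (minSplit y ys)

minSplit-correct : ∀ x xs → IsMinSplit (x ∷ xs) (minSplit x xs)
minSplit-correct x [] = refl , [] , []
minSplit-correct x (y ∷ ys) with minSplit y ys | minSplit-correct y ys
... | α , m , β | e , α>m , β≥m with m <? x
... | yes m<x rewrite <ᵇ-true m<x = cong (x ∷_) e , m<x ∷ α>m , β≥m
... | no m≮x rewrite <ᵇ-false (≮⇒≥ m≮x) =
  refl , [] , subst (All (x ≤_)) (sym e) (All.map (≤-trans (≮⇒≥ m≮x)) α++m∷β≥m)
  where
  α++m∷β≥m : All (m ≤_) (α ++ m ∷ β)
  α++m∷β≥m = All.++⁺ (All.map <⇒≤ α>m) (≤-refl ∷ β≥m)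

minSplit-unique : ∀ x xs {α m β} → IsMinSplit (x ∷ xs) (α , m , β) → minSplit x xs ≡ (α , m , β)
minSplit-unique x [] {[]} (refl , _ , _) = refl
minSplit-unique x [] {_ ∷ []} (() , _ , _)
minSplit-unique x [] {_ ∷ _ ∷ _} (() , _ , _)
minSplit-unique x (y ∷ ys) {[]} (refl , _ , x≤ys) with minSplit y ys | minSplit-correct y ys
... | α′ , m′ , β′ | e , _ , _ rewrite <ᵇ-false (All.head (All.++⁻ʳ α′ (subst (All (x ≤_)) e x≤ys))) =
  refl
minSplit-unique x (y ∷ ys) {a ∷ α} (e , a>m ∷ α>m , β≥m) with ∷-injective e
... | refl , e′ rewrite minSplit-unique y ys (e′ , α>m , β≥m) | <ᵇ-true a>m = refl

split-shorter : ∀ {f} {w : List ℕ} α m β → w ≡ α ++ m ∷ β → length w ≤ suc f →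
  length α ≤ f × length β ≤ f
split-shorter {f} α m β refl |w|≤1+f =
  shorter (m≤m+n (length α) (length β)) , shorter (m≤n+m (length β) (length α))
  where
  |w|≡ : length (α ++ m ∷ β) ≡ suc (length α + length β)
  |w|≡ = trans (length-mid α m β) (cong suc (length-++ α))
  shorter : ∀ {k} → k ≤ length α + length β → k ≤ f
  shorter k≤ = ≤-pred (≤-trans (s≤s k≤) (subst (_≤ suc f) |w|≡ |w|≤1+f))

assemble : (List ℕ → List ℕ) → Split → List ℕ
assemble g ([] , m , β) = g β ++ [ m ]
assemble g (a ∷ α , m , []) = m ∷ g (a ∷ α)
assemble g (a ∷ α , m , b ∷ β) = g (a ∷ α) ++ m ∷ reverse (b ∷ β)

assemble-snoc : ∀ g α m → α ≢ [] → assemble g (α , m , []) ≡ m ∷ g α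
assemble-snoc g [] m α≢[] = contradiction refl α≢[]
assemble-snoc g (a ∷ α) m _ = refl

assemble-mid : ∀ g α m β → α ≢ [] → β ≢ [] → assemble g (α , m , β) ≡ g α ++ m ∷ reverse β
assemble-mid g [] m β α≢[] _ = contradiction refl α≢[]
assemble-mid g (a ∷ α) m [] _ β≢[] = contradiction refl β≢[]
assemble-mid g (a ∷ α) m (b ∷ β) _ _ = refl

assemble-cong : ∀ {g h} α m β → g α ≡ h α → g β ≡ h β →
  assemble g (α , m , β) ≡ assemble h (α , m , β)
assemble-cong [] m β _ gβ = cong (_++ [ m ]) gβ
assemble-cong (a ∷ α) m [] gα _ = cong (m ∷_) gα
assemble-cong (a ∷ α) m (b ∷ β) gα _ = cong (_++ m ∷ reverse (b ∷ β)) gα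

-- Φ w = φ (length w) w below; the fuel only makes the recursion structural and is irrelevant
-- as soon as it is at least the length (φ-fuel)
φ : ℕ → List ℕ → List ℕ
φ zero w = w
φ (suc f) [] = []
φ (suc f) (x ∷ xs) = assemble (φ f) (minSplit x xs)

φ-[] : ∀ f → φ f [] ≡ []
φ-[] zero = refl
φ-[] (suc f) = refl

φ-fuel : ∀ f g w → length w ≤ f → length w ≤ g → φ f w ≡ φ g w
φ-fuel f g [] _ _ = trans (φ-[] f) (sym (φ-[] g))
φ-fuel (suc f) (suc g) (x ∷ xs) |w|≤f |w|≤g with minSplit x xs | minSplit-correct x xs
... | α , m , β | e , _ , _ with split-shorter α m β e |w|≤f | split-shorter α m β e |w|≤g
... | |α|≤f , |β|≤f | |α|≤g , |β|≤g =
  assemble-cong α m β (φ-fuel f g α |α|≤f |α|≤g) (φ-fuel f g β |β|≤f |β|≤g)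

Φ : List ℕ → List ℕ
Φ w = φ (length w) w

Φ-splitᶜ : ∀ x xs {α m β} → IsMinSplit (x ∷ xs) (α , m , β) →
  Φ (x ∷ xs) ≡ assemble Φ (α , m , β)
Φ-splitᶜ x xs {α} {m} {β} s@(e , _) rewrite minSplit-unique x xs s =
  assemble-cong α m β (φ-fuel _ _ α (proj₁ shorter) ≤-refl) (φ-fuel _ _ β (proj₂ shorter) ≤-refl)
  where shorter = split-shorter α m β e ≤-refl

Φ-split : ∀ α m β → All (m <_) α → All (m ≤_) β → Φ (α ++ m ∷ β) ≡ assemble Φ (α , m , β)
Φ-split [] m β α>m β≥m = Φ-splitᶜ m β (refl , α>m , β≥m)
Φ-split (a ∷ α) m β α>m β≥m = Φ-splitᶜ a (α ++ m ∷ β) (refl , α>m , β≥m)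

minSplit-induction : (P : List ℕ → Set) → P [] →
  (∀ α m β → All (m <_) α → All (m ≤_) β → P α → P β → P (α ++ m ∷ β)) → ∀ w → P w
minSplit-induction P base step w = go (length w) w ≤-refl
  where
  go : ∀ f w → length w ≤ f → P w
  go f [] _ = base
  go (suc f) (x ∷ xs) |w|≤1+f with minSplit x xs | minSplit-correct x xs
  ... | α , m , β | e , α>m , β≥m = subst P (sym e)
    (step α m β α>m β≥m (go f α (proj₁ shorter)) (go f β (proj₂ shorter)))
    where shorter = split-shorter α m β e |w|≤1+f

assemble-↭ : ∀ {g} α m β → g α ↭ α → g β ↭ β → assemble g (α , m , β) ↭ α ++ m ∷ β
assemble-↭ {g} [] m β _ gβ↭β = ↭-trans (↭.++-comm (g β) [ m ]) (prep m gβ↭β)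
assemble-↭ (a ∷ α) m [] gα↭α _ = ↭-trans (prep m gα↭α) (↭.++-comm [ m ] (a ∷ α))
assemble-↭ (a ∷ α) m (b ∷ β) gα↭α _ = ↭.++⁺ gα↭α (prep m (↭.↭-reverse (b ∷ β)))

Φ-↭ : ∀ w → Φ w ↭ w
Φ-↭ = minSplit-induction (λ w → Φ w ↭ w) ↭-refl
  (λ α m β α>m β≥m Φα↭α Φβ↭β →
    ↭-trans (↭-reflexive (Φ-split α m β α>m β≥m)) (assemble-↭ α m β Φα↭α Φβ↭β))

Φ-All : ∀ {P : ℕ → Set} {w} → All P w → All P (Φ w)
Φ-All {w = w} = ↭.All-resp-↭ (↭-sym (Φ-↭ w))

Φ-∈ : ∀ {x w} → x ∈ w → x ∈ Φ w
Φ-∈ {w = w} = ↭.∈-resp-↭ (↭-sym (Φ-↭ w))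

Φ-Unique : ∀ {w} → Unique w → Unique (Φ w)
Φ-Unique {w} = Unique-resp-↭ (↭-sym (Φ-↭ w))

Φ-length : ∀ w → length (Φ w) ≡ length w
Φ-length w = ↭.↭-length (Φ-↭ w)

Φ-∷≢[] : ∀ a α → Φ (a ∷ α) ≢ []
Φ-∷≢[] a α = length-suc⇒≢[] (Φ-length (a ∷ α))

split-unique : ∀ α m β → Unique (α ++ m ∷ β) → All (m ≤_) β →
  Unique α × Unique β × All (m <_) β
split-unique α m β u β≥m with AllPairs-++⁻ α u
... | uα , (m∉β ∷ uβ) = uα , uβ , All.zipWith (λ (m≤ , m≢) → ≤∧≢⇒< m≤ m≢) (β≥m , m∉β)

unique-minSplit-induction : (P : List ℕ → Set) → P [] →
  (∀ α m β → All (m <_) α → All (m <_) β → P α → P β → P (α ++ m ∷ β)) → ∀ w → Unique w → P w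
unique-minSplit-induction P base step = minSplit-induction (λ w → Unique w → P w) (λ _ → base) step′
  where
  step′ : ∀ α m β → All (m <_) α → All (m ≤_) β → (Unique α → P α) → (Unique β → P β) →
    Unique (α ++ m ∷ β) → P (α ++ m ∷ β)
  step′ α m β α>m β≥m ihα ihβ u with split-unique α m β u β≥m
  ... | uα , uβ , β>m = step α m β α>m β>m (ihα uα) (ihβ uβ)

asc-assemble : ∀ α m β → All (m <_) α → All (m <_) β →
  asc (Φ α) ≡ des α → asc (Φ β) ≡ des β → asc (assemble Φ (α , m , β)) ≡ des (α ++ m ∷ β)
asc-assemble [] m β _ β>m _ ihβ = begin
  asc (Φ β ++ [ m ]) ≡⟨ asc-snoc-≤ (Φ β) (Φ-All (All.map <⇒≤ β>m)) ⟩
  asc (Φ β)          ≡⟨ ihβ ⟩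
  des β              ≡⟨ des-cons-≤ β (All.map <⇒≤ β>m) ⟨
  des (m ∷ β)        ∎
  where open ≡-Reasoning
asc-assemble (a ∷ α) m [] α>m _ ihα _ = begin
  asc (m ∷ Φ (a ∷ α))       ≡⟨ asc-cons-< (Φ (a ∷ α)) (Φ-All α>m) (Φ-∷≢[] a α) ⟩
  suc (asc (Φ (a ∷ α)))     ≡⟨ cong suc ihα ⟩
  suc (des (a ∷ α))         ≡⟨ des-snoc-< (a ∷ α) α>m (λ ()) ⟨
  des ((a ∷ α) ++ [ m ])    ∎
  where open ≡-Reasoning
asc-assemble (a ∷ α) m (b ∷ β) α>m β>m ihα _ = begin
  asc (Φ u ++ m ∷ reverse v)                       ≡⟨ asc-++ (Φ u) m (reverse v) ⟩
  asc (Φ u ++ [ m ]) + asc (m ∷ reverse v)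
    ≡⟨ cong₂ _+_ (asc-snoc-≤ (Φ u) (All.map <⇒≤ (Φ-All α>m)))
                 (asc-cons-< (reverse v) (All-reverse β>m) (reverse-∷≢[] b β)) ⟩
  asc (Φ u) + suc (asc (reverse v))                ≡⟨ cong₂ (λ x y → x + suc y) ihα (asc-reverse v) ⟩
  des u + suc (des v)                              ≡⟨ +-suc (des u) (des v) ⟩
  suc (des u) + des v
    ≡⟨ cong₂ _+_ (des-snoc-< u α>m (λ ())) (des-cons-≤ v (All.map <⇒≤ β>m)) ⟨
  des (u ++ [ m ]) + des (m ∷ v)                   ≡⟨ des-++ u m v ⟨
  des (u ++ m ∷ v)                                 ∎
  where
  open ≡-Reasoning
  u = a ∷ α
  v = b ∷ β

asc-Φ : ∀ w → Unique w → asc (Φ w) ≡ des w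
asc-Φ = unique-minSplit-induction (λ w → asc (Φ w) ≡ des w) refl λ α m β α>m β>m ihα ihβ →
  trans (cong asc (Φ-split α m β α>m (All.map <⇒≤ β>m))) (asc-assemble α m β α>m β>m ihα ihβ)

Φ-assemble : ∀ α m β → All (m <_) α → All (m <_) β → Φ (Φ α) ≡ α → Φ (Φ β) ≡ β →
  Φ (assemble Φ (α , m , β)) ≡ α ++ m ∷ β
Φ-assemble [] m [] _ _ _ _ = refl
Φ-assemble [] m (b ∷ β) _ β>m _ ihβ = begin
  Φ (Φ (b ∷ β) ++ [ m ])            ≡⟨ Φ-split (Φ (b ∷ β)) m [] (Φ-All β>m) [] ⟩
  assemble Φ (Φ (b ∷ β) , m , [])   ≡⟨ assemble-snoc Φ (Φ (b ∷ β)) m (Φ-∷≢[] b β) ⟩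
  m ∷ Φ (Φ (b ∷ β))                 ≡⟨ cong (m ∷_) ihβ ⟩
  m ∷ b ∷ β                         ∎
  where open ≡-Reasoning
Φ-assemble (a ∷ α) m [] α>m _ ihα _ = begin
  Φ (m ∷ Φ (a ∷ α))        ≡⟨ Φ-split [] m (Φ (a ∷ α)) [] (All.map <⇒≤ (Φ-All α>m)) ⟩
  Φ (Φ (a ∷ α)) ++ [ m ]   ≡⟨ cong (_++ [ m ]) ihα ⟩
  (a ∷ α) ++ [ m ]         ∎
  where open ≡-Reasoning
Φ-assemble (a ∷ α) m (b ∷ β) α>m β>m ihα _ = begin
  Φ (Φ u ++ m ∷ reverse v)
    ≡⟨ Φ-split (Φ u) m (reverse v) (Φ-All α>m) (All-reverse (All.map <⇒≤ β>m)) ⟩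
  assemble Φ (Φ u , m , reverse v)
    ≡⟨ assemble-mid Φ (Φ u) m (reverse v) (Φ-∷≢[] a α) (reverse-∷≢[] b β) ⟩
  Φ (Φ u) ++ m ∷ reverse (reverse v)
    ≡⟨ cong₂ (λ x y → x ++ m ∷ y) ihα (reverse-involutive v) ⟩
  u ++ m ∷ v
    ∎
  where
  open ≡-Reasoning
  u = a ∷ α
  v = b ∷ β

Φ-involutive : ∀ w → Unique w → Φ (Φ w) ≡ w
Φ-involutive = unique-minSplit-induction (λ w → Φ (Φ w) ≡ w) refl λ α m β α>m β>m ihα ihβ →
  trans (cong Φ (Φ-split α m β α>m (All.map <⇒≤ β>m))) (Φ-assemble α m β α>m β>m ihα ihβ)

IncToPreserved : ℕ → List ℕ → Set
IncToPreserved M w = All (_≤ M) w → M ∈ w → incTo M w ≡ true → incTo M (Φ w) ≡ true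

incTo-assemble : ∀ {M} α m β → All (m <_) α → All (m <_) β → IncToPreserved M α → IncToPreserved M β →
  All (_≤ M) (α ++ m ∷ β) → M ∈ α ++ m ∷ β → incTo M (α ++ m ∷ β) ≡ true →
  incTo M (assemble Φ (α , m , β)) ≡ true
incTo-assemble [] m [] _ _ _ _ _ _ _ = refl
incTo-assemble {M} [] m (b ∷ β) _ (m<b ∷ β>m) _ ihβ (m≤M ∷ β≤M) M∈w inc =
  incTo-++⁺ (Φ (b ∷ β)) [ m ] (ihβ β≤M M∈β incβ) (Φ-∈ M∈β)
  where
  m≢M : m ≢ M
  m≢M m≡M = <-irrefl m≡M (<-≤-trans m<b (All.head β≤M))
  M∈β : M ∈ b ∷ β
  M∈β = ∈-mid⁻ [] M∈w (m≢M ∘ sym)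
  incβ : incTo M (b ∷ β) ≡ true
  incβ with incTo-∷∷⁻ {w = β} inc
  ... | inj₁ m≡M = contradiction m≡M m≢M
  ... | inj₂ (_ , inc′) = inc′
incTo-assemble {M} (a ∷ α) m [] α>m _ ihα _ w≤M M∈w inc =
  incTo-∷⁺ (Φ (a ∷ α)) m≢M (Φ-All α>m)
    (ihα (All.++⁻ˡ (a ∷ α) w≤M) M∈α (incTo-++⁻ (a ∷ α) [ m ] inc))
  where
  m≢M : m ≢ M
  m≢M m≡M = <-irrefl m≡M (<-≤-trans (All.head α>m) (All.head w≤M))
  M∈α : M ∈ a ∷ α
  M∈α with ∈-++⁻ (a ∷ α) M∈w
  ... | inj₁ M∈ = M∈
  ... | inj₂ (here M≡m) = contradiction (sym M≡m) m≢M
incTo-assemble {M} (a ∷ α) m (b ∷ β) α>m _ ihα _ w≤M M∈w inc =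
  incTo-++⁺ (Φ (a ∷ α)) (m ∷ reverse (b ∷ β))
    (ihα (All.++⁻ˡ (a ∷ α) w≤M) M∈α (incTo-++⁻ (a ∷ α) (m ∷ b ∷ β) inc)) (Φ-∈ M∈α)
  where
  M∈α : M ∈ a ∷ α
  M∈α with M ∈? a ∷ α
  ... | yes M∈ = M∈
  ... | no M∉ = contradiction inc (incTo-descent a α (b ∷ β) M∉ α>m)

incTo-Φ : ∀ M w → Unique w → All (_≤ M) w → M ∈ w → incTo M w ≡ true → incTo M (Φ w) ≡ true
incTo-Φ M = unique-minSplit-induction (IncToPreserved M) (λ _ ()) λ α m β α>m β>m ihα ihβ w≤M M∈w inc →
  subst (λ w → incTo M w ≡ true) (sym (Φ-split α m β α>m (All.map <⇒≤ β>m)))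
    (incTo-assemble α m β α>m β>m ihα ihβ w≤M M∈w inc)

Φ-Q : ∀ n {w} → w ∈ Q (suc n) → Φ w ∈ Q (suc n)
Φ-Q n {w} w∈ with ∈-Q⁻ {suc n} w∈
... | |w| , w⊆ , u , inc = ∈-Q⁺ {suc n} (trans (Φ-length w) |w|) (Φ-All w⊆) (Φ-Unique u)
  (incTo-Φ (suc n) w u (All.map proj₂ w⊆) (unique-full u w⊆ |w| (InRange-top n)) inc)

count-asc≡count-des : ∀ n k →
  count (λ π → asc π ≡ᵇ k) (Q (suc n)) ≡ count (λ π → des π ≡ᵇ k) (Q (suc n))
count-asc≡count-des n k = begin
  count (λ π → asc π ≡ᵇ k) (Q (suc n))         ≡⟨ count≡∑ _ (Q (suc n)) ⟩
  ∑ (λ π → indicator (asc π ≡ᵇ k)) (Q (suc n))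
    ≡⟨ ∑-involution Φ (Q-unique (suc n)) (Φ-Q n) (λ w∈ → Φ-involutive _ (unique w∈)) _ ⟩
  ∑ (λ π → indicator (asc (Φ π) ≡ᵇ k)) (Q (suc n))
    ≡⟨ ∑-cong (Q (suc n)) (λ w∈ → cong (λ d → indicator (d ≡ᵇ k)) (asc-Φ _ (unique w∈))) ⟩
  ∑ (λ π → indicator (des π ≡ᵇ k)) (Q (suc n))  ≡⟨ count≡∑ _ (Q (suc n)) ⟨
  count (λ π → des π ≡ᵇ k) (Q (suc n))         ∎
  where
  open ≡-Reasoning
  unique : ∀ {w} → w ∈ Q (suc n) → Unique w
  unique w∈ = proj₁ (proj₂ (proj₂ (∈-Q⁻ {suc n} w∈)))

-- Descents of injective words

insertions : ℕ → List ℕ → List (List ℕ)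
insertions M [] = [ M ] ∷ []
insertions M (x ∷ xs) = (M ∷ x ∷ xs) ∷ map (x ∷_) (insertions M xs)

-- inserting a new largest letter into a word of length k with d descents: the d descent slots and
-- the end keep the descent number, the other k ∸ d slots raise it by one
insertionSum : (ℕ → ℕ) → ℕ → ℕ → ℕ
insertionSum g k d = suc d * g d + (k ∸ d) * g (suc d)

∑-insertions-behind : ∀ M (g : ℕ → ℕ) x xs → All (_< M) (x ∷ xs) → Unique (x ∷ xs) →
  ∑ (λ u → g (des (x ∷ u))) (insertions M xs) ≡
  suc (des (x ∷ xs)) * g (des (x ∷ xs)) + asc (x ∷ xs) * g (suc (des (x ∷ xs)))
∑-insertions-behind M g x [] (x<M ∷ []) _ rewrite <ᵇ-false (<⇒≤ x<M) =
  solve 1 (λ a → a :+ con 0 := (con 1 :+ con 0) :* a :+ con 0 :* a) refl (g 0)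
∑-insertions-behind M g x (y ∷ ys) (x<M ∷ y<M ∷ ys<M) ((x≢y ∷ _) ∷ u) = begin
  g (des (x ∷ M ∷ y ∷ ys)) + ∑ (λ v → g (des (x ∷ v))) (map (y ∷_) (insertions M ys))
    ≡⟨ cong₂ _+_ (cong g des-xMy) (∑-map (λ v → g (des (x ∷ v))) (y ∷_) (insertions M ys)) ⟩
  g (suc d′) + ∑ (λ v → g (b + des (y ∷ v))) (insertions M ys)
    ≡⟨ cong (g (suc d′) +_) (∑-insertions-behind M (λ t → g (b + t)) y ys (y<M ∷ ys<M) u) ⟩
  g (suc d′) + (suc d′ * g (b + d′) + a′ * g (b + suc d′))
    ≡⟨ regroup ⟩
  suc (des (x ∷ y ∷ ys)) * g (des (x ∷ y ∷ ys)) + asc (x ∷ y ∷ ys) * g (suc (des (x ∷ y ∷ ys))) ∎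
  where
  open ≡-Reasoning
  b = if y <ᵇ x then 1 else 0
  d′ = des (y ∷ ys)
  a′ = asc (y ∷ ys)
  des-xMy : des (x ∷ M ∷ y ∷ ys) ≡ suc d′
  des-xMy rewrite <ᵇ-false (<⇒≤ x<M) | <ᵇ-true y<M = refl
  regroup : g (suc d′) + (suc d′ * g (b + d′) + a′ * g (b + suc d′)) ≡
            suc (des (x ∷ y ∷ ys)) * g (des (x ∷ y ∷ ys)) + asc (x ∷ y ∷ ys) * g (suc (des (x ∷ y ∷ ys)))
  regroup with y <? x
  ... | yes y<x rewrite <ᵇ-true y<x | <ᵇ-false (<⇒≤ y<x) =
    solve 4 (λ p q e f → p :+ ((con 1 :+ e) :* p :+ f :* q)
                       := (con 1 :+ (con 1 :+ e)) :* p :+ (con 0 :+ f) :* q) refl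
      (g (suc d′)) (g (suc (suc d′))) d′ a′
  ... | no y≮x rewrite <ᵇ-false (≮⇒≥ y≮x) | <ᵇ-true (≤∧≢⇒< (≮⇒≥ y≮x) x≢y) =
    solve 4 (λ p q e f → p :+ ((con 1 :+ e) :* q :+ f :* p)
                       := (con 1 :+ (con 0 :+ e)) :* q :+ (con 1 :+ f) :* p) refl
      (g (suc d′)) (g d′) d′ a′

∑-insertions : ∀ M (g : ℕ → ℕ) ρ → All (_< M) ρ → Unique ρ →
  ∑ (g ∘ des) (insertions M ρ) ≡ insertionSum g (length ρ) (des ρ)
∑-insertions M g [] _ _ = solve 1 (λ a → a :+ con 0 := (con 1 :+ con 0) :* a :+ con 0 :* a) refl (g 0)
∑-insertions M g (x ∷ xs) ρ<M u = begin
  g (des (M ∷ x ∷ xs)) + ∑ (g ∘ des) (map (x ∷_) (insertions M xs))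
    ≡⟨ cong₂ _+_ (cong g des-Mx) (∑-map (g ∘ des) (x ∷_) (insertions M xs)) ⟩
  g (suc d) + ∑ (λ v → g (des (x ∷ v))) (insertions M xs)
    ≡⟨ cong (g (suc d) +_) (∑-insertions-behind M g x xs ρ<M u) ⟩
  g (suc d) + (suc d * g d + a * g (suc d))
    ≡⟨ solve 4 (λ p q e f → p :+ ((con 1 :+ e) :* q :+ f :* p) := (con 1 :+ e) :* q :+ (con 1 :+ f) :* p)
         refl (g (suc d)) (g d) d a ⟩
  suc d * g d + suc a * g (suc d)
    ≡⟨ cong (λ z → suc d * g d + z * g (suc d)) 1+a≡k∸d ⟩
  insertionSum g (length (x ∷ xs)) d ∎
  where
  open ≡-Reasoning
  d = des (x ∷ xs)
  a = asc (x ∷ xs)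
  des-Mx : des (M ∷ x ∷ xs) ≡ suc d
  des-Mx rewrite <ᵇ-true (All.head ρ<M) = refl
  1+a≡k∸d : suc a ≡ suc (length xs) ∸ d
  1+a≡k∸d = sym (trans (cong (λ k → suc k ∸ d) (sym (asc+des x xs u))) (m+n∸n≡m (suc a) d))

delete : ℕ → List ℕ → List ℕ
delete M [] = []
delete M (a ∷ w) = if a ≡ᵇ M then w else a ∷ delete M w

delete-mid : ∀ M u v → M ∉ u → delete M (u ++ M ∷ v) ≡ u ++ v
delete-mid M [] v _ rewrite ≡ᵇ-refl M = refl
delete-mid M (a ∷ u) v M∉ rewrite ≡ᵇ-false {a} {M} (λ a≡M → M∉ (here (sym a≡M))) =
  cong (a ∷_) (delete-mid M u v (M∉ ∘ there))

∈-insertions⁻ : ∀ {M ρ y} → y ∈ insertions M ρ → ∃₂ λ u v → ρ ≡ u ++ v × y ≡ u ++ M ∷ v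
∈-insertions⁻ {ρ = []} (here refl) = [] , [] , refl , refl
∈-insertions⁻ {ρ = x ∷ xs} (here refl) = [] , x ∷ xs , refl , refl
∈-insertions⁻ {M} {x ∷ xs} (there y∈) with ∈-map⁻ (x ∷_) y∈
... | _ , y′∈ , refl with ∈-insertions⁻ {M} {xs} y′∈
... | u , v , refl , refl = x ∷ u , v , refl , refl

∈-insertions⁺ : ∀ M u v → u ++ M ∷ v ∈ insertions M (u ++ v)
∈-insertions⁺ M [] [] = here refl
∈-insertions⁺ M [] (x ∷ v) = here refl
∈-insertions⁺ M (a ∷ u) v = there (∈-map⁺ (a ∷_) (∈-insertions⁺ M u v))

insertions-unique : ∀ M ρ → M ∉ ρ → Unique (insertions M ρ)
insertions-unique M [] _ = [] ∷ []
insertions-unique M (x ∷ xs) M∉ =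
  All.tabulate fresh ∷ Unique.map⁺ ∷-injectiveʳ (insertions-unique M xs (M∉ ∘ there))
  where
  fresh : ∀ {w} → w ∈ map (x ∷_) (insertions M xs) → M ∷ x ∷ xs ≢ w
  fresh w∈ M∷x∷xs≡w with ∈-map⁻ (x ∷_) w∈
  ... | _ , _ , refl = M∉ (here (∷-injectiveˡ M∷x∷xs≡w))

topInsertions : ℕ → ℕ → List (List ℕ)
topInsertions n k = concatMap (insertions (suc n)) (injWords n k)

∈-topInsertions⁻ : ∀ {n k w} → w ∈ topInsertions n k →
  ∃₂ λ u v → w ≡ u ++ suc n ∷ v × u ++ v ∈ injWords n k
∈-topInsertions⁻ {n} {k} w∈ with find (∈-concatMap⁻ (insertions (suc n)) {xs = injWords n k} w∈)
... | ρ , ρ∈ , w∈ρ with ∈-insertions⁻ w∈ρ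
... | u , v , refl , refl = u , v , refl , ρ∈

∈-topInsertions⁺ : ∀ {n k} u v → u ++ v ∈ injWords n k → u ++ suc n ∷ v ∈ topInsertions n k
∈-topInsertions⁺ {n} u v uv∈ = ∈-concatMap⁺ (insertions (suc n)) (lose uv∈ (∈-insertions⁺ (suc n) u v))

topInsertions-unique : ∀ n k → Unique (topInsertions n k)
topInsertions-unique n k = Unique-concatMap (insertions (suc n)) (delete (suc n)) label (injWords-unique n k)
  (λ ρ∈ → insertions-unique (suc n) _ (top∉ (proj₁ (proj₂ (∈-injWords⁻ {n} {k} ρ∈)))))
  where
  label : ∀ {ρ w} → ρ ∈ injWords n k → w ∈ insertions (suc n) ρ → delete (suc n) w ≡ ρ
  label ρ∈ w∈ with ∈-insertions⁻ w∈
  ... | u , v , refl , refl = delete-mid (suc n) u v (top∉ (proj₁ (proj₂ (∈-injWords⁻ {n} {k} ρ∈))) ∘ ∈-++⁺ˡ)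

∈-injWords-suc⁻ : ∀ {n k w} → w ∈ injWords (suc n) (suc k) →
  w ∈ injWords n (suc k) ++ topInsertions n k
∈-injWords-suc⁻ {n} {k} {w} w∈ with ∈-injWords⁻ {suc n} {suc k} w∈
... | |w| , w⊆ , u with suc n ∈? w
... | no top∉w =
  ∈-++⁺ˡ (∈-injWords⁺ |w| (All.tabulate (λ a∈ → InRange-pred (All.lookup w⊆ a∈) (λ { refl → top∉w a∈ }))) u)
... | yes top∈w with ∈-∃++ top∈w
... | w₁ , w₂ , refl =
  ∈-++⁺ʳ (injWords n (suc k)) (∈-topInsertions⁺ {n} {k} w₁ w₂ (∈-injWords⁺ |w₁w₂| w₁w₂⊆ (Unique.drop⁺ 1 u′)))
  where
  u′ : Unique (suc n ∷ w₁ ++ w₂)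
  u′ = Unique-resp-↭ (↭.shift (suc n) w₁ w₂) u
  |w₁w₂| : length (w₁ ++ w₂) ≡ k
  |w₁w₂| = suc-injective (trans (sym (length-mid w₁ (suc n) w₂)) |w|)
  w₁w₂⊆ : All (InRange n) (w₁ ++ w₂)
  w₁w₂⊆ with ↭.All-resp-↭ (↭.shift (suc n) w₁ w₂) w⊆ | u′
  ... | _ ∷ w₁w₂⊆′ | top∉ ∷ _ = All.zipWith (λ (a∈ , a≢) → InRange-pred a∈ (a≢ ∘ sym)) (w₁w₂⊆′ , top∉)

∈-injWords-suc⁺ : ∀ {n k w} → w ∈ injWords n (suc k) ++ topInsertions n k →
  w ∈ injWords (suc n) (suc k)
∈-injWords-suc⁺ {n} {k} w∈ with ∈-++⁻ (injWords n (suc k)) w∈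
... | inj₁ w∈′ with ∈-injWords⁻ {n} {suc k} w∈′
... | |w| , w⊆ , u = ∈-injWords⁺ |w| (All.map InRange-suc w⊆) u
∈-injWords-suc⁺ {n} {k} w∈ | inj₂ w∈′ with ∈-topInsertions⁻ {n} {k} w∈′
... | w₁ , w₂ , refl , ρ∈ with ∈-injWords⁻ {n} {k} ρ∈
... | |ρ| , ρ⊆ , u = ∈-injWords⁺ (trans (length-mid w₁ (suc n) w₂) (cong suc |ρ|))
  (↭.All-resp-↭ (↭-sym (↭.shift (suc n) w₁ w₂)) (InRange-top n ∷ All.map InRange-suc ρ⊆))
  (Unique-resp-↭ (↭-sym (↭.shift (suc n) w₁ w₂)) (All.tabulate (λ { a∈ refl → top∉ ρ⊆ a∈ }) ∷ u))

injWords-suc-↭ : ∀ n k → injWords (suc n) (suc k) ↭ injWords n (suc k) ++ topInsertions n k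
injWords-suc-↭ n k = unique∧⊆⇒↭ (injWords-unique (suc n) (suc k))
  (Unique.++⁺ (injWords-unique n (suc k)) (topInsertions-unique n k) disjoint)
  (∈-injWords-suc⁻ {n} {k}) (∈-injWords-suc⁺ {n} {k})
  where
  disjoint : ∀ {w} → ¬ (w ∈ injWords n (suc k) × w ∈ topInsertions n k)
  disjoint (w∈ , w∈top) with ∈-topInsertions⁻ {n} {k} w∈top
  ... | w₁ , w₂ , refl , _ = top∉ (proj₁ (proj₂ (∈-injWords⁻ {n} {suc k} w∈))) (∈-++⁺ʳ w₁ (here refl))

desSum : ℕ → ℕ → (ℕ → ℕ) → ℕ
desSum n k g = ∑ (g ∘ des) (injWords n k)

desSum-suc : ∀ n k g → desSum (suc n) (suc k) g ≡ desSum n (suc k) g + desSum n k (insertionSum g k)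
desSum-suc n k g = begin
  desSum (suc n) (suc k) g                               ≡⟨ ∑-↭ (g ∘ des) (injWords-suc-↭ n k) ⟩
  ∑ (g ∘ des) (injWords n (suc k) ++ topInsertions n k)  ≡⟨ ∑-++ (g ∘ des) (injWords n (suc k)) _ ⟩
  desSum n (suc k) g + ∑ (g ∘ des) (topInsertions n k)
    ≡⟨ cong (desSum n (suc k) g +_) (∑-concatMap (g ∘ des) (insertions (suc n)) (injWords n k)) ⟩
  desSum n (suc k) g + ∑ (∑ (g ∘ des) ∘ insertions (suc n)) (injWords n k)
    ≡⟨ cong (desSum n (suc k) g +_) (∑-cong (injWords n k) insert) ⟩
  desSum n (suc k) g + desSum n k (insertionSum g k)                ∎
  where
  open ≡-Reasoning
  insert : ∀ {ρ} → ρ ∈ injWords n k →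
    ∑ (g ∘ des) (insertions (suc n) ρ) ≡ insertionSum g k (des ρ)
  insert ρ∈ with ∈-injWords⁻ {n} {k} ρ∈
  ... | refl , ρ⊆ , u = ∑-insertions (suc n) g _ (All.map (s≤s ∘ proj₂) ρ⊆) u

desSum-empty : ∀ n k g → n < k → desSum n k g ≡ 0
desSum-empty zero (suc k) g _ = refl
desSum-empty (suc n) (suc k) g (s≤s n<k) = trans (desSum-suc n k g)
  (cong₂ _+_ (desSum-empty n (suc k) g (m≤n⇒m≤1+n n<k)) (desSum-empty n k (insertionSum g k) n<k))

desSum-binomial : ∀ n k g → desSum n k g ≡ (n C k) * desSum k k g
desSum-binomial n zero g = sym (*-identityˡ _)
desSum-binomial zero (suc k) g = refl
desSum-binomial (suc n) (suc k) g = begin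
  desSum (suc n) (suc k) g                                  ≡⟨ desSum-suc n k g ⟩
  desSum n (suc k) g + desSum n k (insertionSum g k)
    ≡⟨ cong₂ _+_ (desSum-binomial n (suc k) g) (desSum-binomial n k (insertionSum g k)) ⟩
  (n C suc k) * S + (n C k) * desSum k k (insertionSum g k) ≡⟨ cong (λ z → (n C suc k) * S + (n C k) * z) S≡ ⟨
  (n C suc k) * S + (n C k) * S                             ≡⟨ *-distribʳ-+ S (n C suc k) (n C k) ⟨
  ((n C suc k) + (n C k)) * S                               ≡⟨ cong (_* S) (+-comm (n C suc k) (n C k)) ⟩
  ((n C k) + (n C suc k)) * S                               ≡⟨ cong (_* S) (nCk+nC[k+1]≡[n+1]C[k+1] n k) ⟩
  (suc n C suc k) * S                                       ∎
  where
  open ≡-Reasoning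
  S = desSum (suc k) (suc k) g
  S≡ : S ≡ desSum k k (insertionSum g k)
  S≡ = trans (desSum-suc k k g) (cong (_+ desSum k k (insertionSum g k)) (desSum-empty k (suc k) g ≤-refl))

-- Decomposition of 𝒬 (n + 1)

complement : ℕ → List ℕ → List ℕ
complement n τ = filter (λ x → ¬? (x ∈? τ)) (range n)

∈-complement⁻ : ∀ {n τ x} → x ∈ complement n τ → InRange n x × x ∉ τ
∈-complement⁻ {n} {τ} x∈ with ∈-filter⁻ (λ x → ¬? (x ∈? τ)) {xs = range n} x∈
... | x∈range , x∉τ = ∈-range⁻ x∈range , x∉τ

∈-complement⁺ : ∀ {n τ x} → InRange n x → x ∉ τ → x ∈ complement n τ
∈-complement⁺ {τ = τ} x∈[n] x∉τ = ∈-filter⁺ (λ x → ¬? (x ∈? τ)) (∈-range⁺ x∈[n]) x∉τ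

complement-InRange : ∀ n τ → All (InRange n) (complement n τ)
complement-InRange n τ = All.tabulate (proj₁ ∘ ∈-complement⁻ {n} {τ})

complement<top : ∀ n τ → All (_< suc n) (complement n τ)
complement<top n τ = All.map (s≤s ∘ proj₂) (complement-InRange n τ)

complement-increasing : ∀ n τ → Increasing (complement n τ)
complement-increasing n τ = AllPairs.filter⁺ (λ x → ¬? (x ∈? τ)) (range-increasing n)

withTop : ℕ → List ℕ → List ℕ
withTop n τ = complement n τ ++ suc n ∷ τ

allInjWords : ℕ → List (List ℕ)
allInjWords n = injWords n 0 ++ concatMap (injWords n) (range n)

∈-allInjWords⁻ : ∀ {n τ} → τ ∈ allInjWords n → All (InRange n) τ × Unique τ
∈-allInjWords⁻ {n} τ∈ with ∈-++⁻ (injWords n 0) τ∈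
... | inj₁ τ∈₀ = proj₂ (∈-injWords⁻ {n} {0} τ∈₀)
... | inj₂ τ∈ₖ with find (∈-concatMap⁻ (injWords n) {xs = range n} τ∈ₖ)
... | k , _ , τ∈′ = proj₂ (∈-injWords⁻ {n} {k} τ∈′)

∈-allInjWords⁺ : ∀ {n τ} → All (InRange n) τ → Unique τ → τ ∈ allInjWords n
∈-allInjWords⁺ {n} {[]} _ _ = ∈-++⁺ˡ (∈-injWords⁺ {n} {0} refl [] [])
∈-allInjWords⁺ {n} {t ∷ ts} τ⊆ u = ∈-++⁺ʳ (injWords n 0)
  (∈-concatMap⁺ (injWords n) (lose (∈-range⁺ (s≤s z≤n , |τ|≤n)) (∈-injWords⁺ refl τ⊆ u)))
  where
  |τ|≤n : length (t ∷ ts) ≤ n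
  |τ|≤n = subst (length (t ∷ ts) ≤_) (length-range n) (unique⊆⇒length≤ u (∈-range⁺ ∘ All.lookup τ⊆))

allInjWords-unique : ∀ n → Unique (allInjWords n)
allInjWords-unique n = Unique.++⁺ (injWords-unique n 0)
  (Unique-concatMap (injWords n) length label (range-unique n) (λ {k} _ → injWords-unique n k)) disjoint
  where
  label : ∀ {k τ} → k ∈ range n → τ ∈ injWords n k → length τ ≡ k
  label {k} _ τ∈ = proj₁ (∈-injWords⁻ {n} {k} τ∈)
  disjoint : ∀ {τ} → ¬ (τ ∈ injWords n 0 × τ ∈ concatMap (injWords n) (range n))
  disjoint (τ∈₀ , τ∈ₖ) with find (∈-concatMap⁻ (injWords n) {xs = range n} τ∈ₖ)
  ... | k , k∈ , τ∈′ with ∈-injWords⁻ {n} {0} τ∈₀ | ∈-injWords⁻ {n} {k} τ∈′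
  ...   | |τ|≡0 , _ | |τ|≡k , _ = <-irrefl (trans (sym |τ|≡0) |τ|≡k) (proj₁ (∈-range⁻ k∈))

withTop-Q : ∀ n {τ} → τ ∈ allInjWords n → withTop n τ ∈ Q (suc n)
withTop-Q n {τ} τ∈ with ∈-allInjWords⁻ τ∈
... | τ⊆ , u = ∈-Q⁺ (trans (↭.↭-length π↭[1+n]) (length-range (suc n))) π⊆ πu
  (incTo-increasing (complement n τ) τ (complement-increasing n τ) (complement<top n τ))
  where
  π⊆ : All (InRange (suc n)) (withTop n τ)
  π⊆ = All.++⁺ (All.map InRange-suc (complement-InRange n τ)) (InRange-top n ∷ All.map InRange-suc τ⊆)
  πu : Unique (withTop n τ)
  πu = Unique.++⁺ (increasing-unique (complement-increasing n τ))
    (All.tabulate (λ { x∈ refl → top∉ τ⊆ x∈ }) ∷ u) disjoint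
    where
    disjoint : ∀ {x} → ¬ (x ∈ complement n τ × x ∈ suc n ∷ τ)
    disjoint (x∈ , here refl) = top∉ (complement-InRange n τ) x∈
    disjoint (x∈ , there x∈τ) = proj₂ (∈-complement⁻ {n} x∈) x∈τ
  onto : ∀ {x} → x ∈ range (suc n) → x ∈ withTop n τ
  onto {x} x∈ with x ≟ suc n | x ∈? τ
  ... | yes refl | _ = ∈-++⁺ʳ (complement n τ) (here refl)
  ... | no _ | yes x∈τ = ∈-++⁺ʳ (complement n τ) (there x∈τ)
  ... | no x≢top | no x∉τ = ∈-++⁺ˡ (∈-complement⁺ (InRange-pred (∈-range⁻ x∈) x≢top) x∉τ)
  π↭[1+n] : withTop n τ ↭ range (suc n)
  π↭[1+n] = unique∧⊆⇒↭ πu (range-unique (suc n)) (∈-range⁺ ∘ All.lookup π⊆) onto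

Q-withTop : ∀ n {π} → π ∈ Q (suc n) → ∃ λ τ → τ ∈ allInjWords n × π ≡ withTop n τ
Q-withTop n {π} π∈ with ∈-Q⁻ {suc n} π∈
... | |π| , π⊆ , u , inc with ∈-∃++ (unique-full u π⊆ |π| (InRange-top n))
... | π₁ , π₂ , refl with Unique-resp-↭ (↭.shift (suc n) π₁ π₂) u | ↭.All-resp-↭ (↭.shift (suc n) π₁ π₂) π⊆
... | top∉π₁π₂ ∷ π₁π₂u | _ ∷ π₁π₂⊆′ =
  π₂ , ∈-allInjWords⁺ (All.++⁻ʳ π₁ π₁π₂⊆) (proj₂ (AllPairs-++⁻ π₁ π₁π₂u)) , cong (_++ suc n ∷ π₂) π₁≡
  where
  π₁π₂⊆ : All (InRange n) (π₁ ++ π₂)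
  π₁π₂⊆ = All.zipWith (λ (x∈ , x≢) → InRange-pred x∈ (x≢ ∘ sym)) (π₁π₂⊆′ , top∉π₁π₂)
  π₁↗ : Increasing π₁
  π₁↗ = incTo-increasing⁻ π₁ π₂ (λ top∈ → All.lookup top∉π₁π₂ (∈-++⁺ˡ top∈) refl) inc
  into : π₁ ⊆ complement n π₂
  into x∈ = ∈-complement⁺ (All.lookup π₁π₂⊆ (∈-++⁺ˡ x∈)) (Unique-++-disjoint π₁ π₁π₂u x∈)
  onto : complement n π₂ ⊆ π₁
  onto x∈ with ∈-complement⁻ {n} {π₂} x∈
  ... | x∈[n] , x∉π₂ with ∈-++⁻ π₁ (unique-full u π⊆ |π| (InRange-suc x∈[n]))
  ...   | inj₁ x∈π₁ = x∈π₁
  ...   | inj₂ (here refl) = contradiction (here refl) (top∉ (x∈[n] ∷ []))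
  ...   | inj₂ (there x∈π₂) = contradiction x∈π₂ x∉π₂
  π₁≡ : π₁ ≡ complement n π₂
  π₁≡ = increasing-↭⇒≡ π₁↗ (complement-increasing n π₂)
    (unique∧⊆⇒↭ (increasing-unique π₁↗) (increasing-unique (complement-increasing n π₂)) into onto)

withTop-injective : ∀ n {τ τ′} → withTop n τ ≡ withTop n τ′ → τ ≡ τ′
withTop-injective n {τ} {τ′} = mid-injective (complement n τ) (complement n τ′)
  (top∉ (complement-InRange n τ)) (top∉ (complement-InRange n τ′))

Q-↭ : ∀ n → Q (suc n) ↭ map (withTop n) (allInjWords n)
Q-↭ n = unique∧⊆⇒↭ (Q-unique (suc n))
  (Unique-map (withTop n) (λ _ _ → withTop-injective n) (allInjWords-unique n)) into onto
  where
  into : ∀ {π} → π ∈ Q (suc n) → π ∈ map (withTop n) (allInjWords n)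
  into π∈ with Q-withTop n π∈
  ... | τ , τ∈ , refl = ∈-map⁺ (withTop n) τ∈
  onto : ∀ {π} → π ∈ map (withTop n) (allInjWords n) → π ∈ Q (suc n)
  onto π∈ with ∈-map⁻ (withTop n) π∈
  ... | τ , τ∈ , refl = withTop-Q n τ∈

des-complement-top : ∀ n τ → des (complement n τ ++ [ suc n ]) ≡ 0
des-complement-top n τ = des-increasing
  (increasing-snoc (complement n τ) (complement-increasing n τ) (complement<top n τ))

des-withTop : ∀ n t ts → All (InRange n) (t ∷ ts) → des (withTop n (t ∷ ts)) ≡ suc (des (t ∷ ts))
des-withTop n t ts ((_ , t≤n) ∷ _) = begin
  des (complement n τ ++ suc n ∷ τ)                    ≡⟨ des-++ (complement n τ) (suc n) τ ⟩
  des (complement n τ ++ [ suc n ]) + des (suc n ∷ τ)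
    ≡⟨ cong (_+ des (suc n ∷ τ)) (des-complement-top n τ) ⟩
  des (suc n ∷ τ)                                      ≡⟨ des-top ⟩
  suc (des τ)                                          ∎
  where
  open ≡-Reasoning
  τ = t ∷ ts
  des-top : des (suc n ∷ τ) ≡ suc (des τ)
  des-top rewrite <ᵇ-true (s≤s t≤n) = refl

-- Σ_{k=1}^n C(n,k) A(k, j − 1), phrased with suc d ≡ᵇ j to avoid the truncated j ∸ 1 at j = 0
binomialEulerian : ℕ → ℕ → ℕ
binomialEulerian n j = ∑ (λ k → (n C k) * desSum k k (λ d → indicator (suc d ≡ᵇ j))) (range n)

count-des-Q : ∀ n j → count (λ π → des π ≡ᵇ j) (Q (suc n)) ≡ δ0 j + binomialEulerian n j
count-des-Q n j = begin
  count (λ π → des π ≡ᵇ j) (Q (suc n))                        ≡⟨ count≡∑ _ (Q (suc n)) ⟩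
  ∑ G (Q (suc n))                                            ≡⟨ ∑-↭ G (Q-↭ n) ⟩
  ∑ G (map (withTop n) (allInjWords n))                      ≡⟨ ∑-map G (withTop n) (allInjWords n) ⟩
  ∑ (G ∘ withTop n) (allInjWords n)
    ≡⟨ ∑-++ (G ∘ withTop n) (injWords n 0) (concatMap (injWords n) (range n)) ⟩
  G (withTop n []) + 0 + ∑ (G ∘ withTop n) (concatMap (injWords n) (range n))
    ≡⟨ cong₂ _+_ (empty j) (∑-concatMap (G ∘ withTop n) (injWords n) (range n)) ⟩
  δ0 j + ∑ (∑ (G ∘ withTop n) ∘ injWords n) (range n)        ≡⟨ cong (δ0 j +_) (∑-cong (range n) nonempty) ⟩
  δ0 j + binomialEulerian n j                                ∎
  where
  open ≡-Reasoning
  G : List ℕ → ℕ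
  G π = indicator (des π ≡ᵇ j)
  empty : ∀ i → indicator (des (withTop n []) ≡ᵇ i) + 0 ≡ δ0 i
  empty i rewrite des-complement-top n [] with i
  ... | zero = refl
  ... | suc _ = refl
  nonempty : ∀ {k} → k ∈ range n →
    ∑ (G ∘ withTop n) (injWords n k) ≡ (n C k) * desSum k k (λ d → indicator (suc d ≡ᵇ j))
  nonempty {k} k∈ = trans (∑-cong (injWords n k) shift) (desSum-binomial n k (λ d → indicator (suc d ≡ᵇ j)))
    where
    shift : ∀ {τ} → τ ∈ injWords n k → G (withTop n τ) ≡ indicator (suc (des τ) ≡ᵇ j)
    shift {τ} τ∈ with τ | ∈-injWords⁻ {n} {k} τ∈
    ... | [] | |τ|≡k , _ = contradiction |τ|≡k (<⇒≢ (proj₁ (∈-range⁻ k∈)))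
    ... | t ∷ ts | _ , τ⊆ , _ = cong (λ d → indicator (d ≡ᵇ j)) (des-withTop n t ts τ⊆)

Atilde≡ : ∀ n j → Atilde n j ≡ δ0 j + binomialEulerian n j
Atilde≡ zero zero = refl
Atilde≡ (suc n) zero = cong suc (sym (trans (∑-cong (range (suc n)) vanish) (∑-zero (range (suc n)))))
  where
  vanish : ∀ {k} → k ∈ range (suc n) → (suc n C k) * desSum k k (λ _ → 0) ≡ 0
  vanish {k} _ = trans (cong ((suc n C k) *_) (∑-zero (injWords k k))) (*-zeroʳ (suc n C k))
Atilde≡ zero (suc j) = refl
Atilde≡ (suc n) (suc j) =
  ∑-cong (range (suc n)) (λ {k} _ → cong ((suc n C k) *_) (count≡∑ (λ π → des π ≡ᵇ j) (perms k)))

theorem2p7 : (n k : ℕ) → Atilde n k ≡ count (λ π → asc π ≡ᵇ k) (Q (suc n))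
theorem2p7 n k = begin
  Atilde n k                             ≡⟨ Atilde≡ n k ⟩
  δ0 k + binomialEulerian n k            ≡⟨ count-des-Q n k ⟨
  count (λ π → des π ≡ᵇ k) (Q (suc n))   ≡⟨ count-asc≡count-des n k ⟨
  count (λ π → asc π ≡ᵇ k) (Q (suc n))   ∎
  where open ≡-Reasoning
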